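{- Let $G=(V,E)$ be a finite graph. Then the rank of $A^c$ equals the height of $\mathrm{Fl}\,G$, i.e. the maximum number of independent columns of $A^c$ equals $\mathrm{ht}\,\mathrm{Fl}\,G$.
   Context: Graphs are finite, undirected, without loops or multiple edges. For $v\in V$, $\mathrm{St}(v)$ is the set of vertices adjacent to $v$; for $W\subseteq V$, $\mathrm{St}(W)=\bigcap_{w\in W}\mathrm{St}(w)$, with $\mathrm{St}(\emptyset)=V$. $\mathrm{Fl}\,G=\{\mathrm{St}(W)\mid W\subseteq V\}$ ordered by inclusion. The height of a finite poset is the maximum $k$ such that it contains a chain $p_0<\dots<p_k$. $A^c$ is the $V\times V$ boolean matrix with $(i,j)$ entry $0$ if $\{i,j\}\in E$ and $1$ otherwise. The superboolean semiring $\mathbb{SB}=\{0,1,1^\nu\}$ has addition $0+x=x$, $1+1=1^\nu$, $1^\nu+x=1^\nu$, and multiplication $0\cdot x=0$, $1\cdot 1=1$, $1\cdot1^\nu=1^\nu\cdot1^\nu=1^\nu$. Vectors $C_1,\dots,C_m\in\mathbb{SB}^n$ are dependent if some combination $\sum\lambda_iC_i$ with $\lambda_i\in\{0,1\}$ not all zero has all coordinates in $\{0,1^\nu\}$; otherwise independent. The rank of a boolean matrix is the maximum number of independent columns. -}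

module Defs where

open import Data.Nat using (ℕ; zero; suc; _≤_; _+_)
open import Data.Fin using (Fin; zero; suc; inject₁)
open import Data.Bool using (Bool; true; false; if_then_else_; not; _∧_; _∨_)
open import Data.Product using (Σ; ∃; _×_; _,_)
open import Data.Sum using (_⊎_)
open import Relation.Binary.PropositionalEquality using (_≡_)
open import Relation.Nullary using (¬_)

record Graph (n : ℕ) : Set where
  field
    adj   : Fin n → Fin n → Bool
    sym   : ∀ i j → adj i j ≡ adj j i
    irref : ∀ i → adj i i ≡ false
open Graph public

Sub : ℕ → Set
Sub n = Fin n → Bool

allFin : ∀ {n} → (Fin n → Bool) → Bool
allFin {zero}  f = true
allFin {suc n} f = f zero ∧ allFin (λ i → f (suc i))

count : ∀ {n} → Sub n → ℕ
count {zero}  S = 0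
count {suc n} S = (if S zero then 1 else 0) + count (λ i → S (suc i))

St : ∀ {n} → Graph n → Sub n → Sub n
St G W v = allFin (λ w → not (W w) ∨ adj G w v)

InFl : ∀ {n} → Graph n → Sub n → Set
InFl G X = Σ (Sub _) λ W → ∀ v → X v ≡ St G W v

_⊂_ : ∀ {n} → Sub n → Sub n → Set
X ⊂ Y = (∀ v → X v ≡ true → Y v ≡ true) × ∃ λ v → (Y v ≡ true) × (X v ≡ false)

record Chain {n} (G : Graph n) (k : ℕ) : Set where
  field
    p     : Fin (suc k) → Sub n
    inFl  : ∀ i → InFl G (p i)
    incr  : ∀ (i : Fin k) → p (inject₁ i) ⊂ p (suc i)

IsHeight : ∀ {n} → Graph n → ℕ → Set
IsHeight G k = Chain G k × (∀ m → Chain G m → m ≤ k)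

data SB : Set where
  𝟘 𝟙 𝟙ν : SB

_+ˢ_ : SB → SB → SB
𝟘 +ˢ x = x
𝟙 +ˢ 𝟘 = 𝟙
𝟙 +ˢ 𝟙 = 𝟙ν
𝟙 +ˢ 𝟙ν = 𝟙ν
𝟙ν +ˢ x = 𝟙ν

_*ˢ_ : SB → SB → SB
𝟘 *ˢ x = 𝟘
𝟙 *ˢ 𝟘 = 𝟘
𝟙 *ˢ 𝟙 = 𝟙
𝟙 *ˢ 𝟙ν = 𝟙ν
𝟙ν *ˢ 𝟘 = 𝟘
𝟙ν *ˢ 𝟙 = 𝟙ν
𝟙ν *ˢ 𝟙ν = 𝟙ν

sumSB : ∀ {n} → (Fin n → SB) → SB
sumSB {zero}  f = 𝟘
sumSB {suc n} f = f zero +ˢ sumSB (λ i → f (suc i))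

fromBool : Bool → SB
fromBool true  = 𝟙
fromBool false = 𝟘

Ac : ∀ {n} → Graph n → Fin n → Fin n → SB
Ac G i j = if adj G i j then 𝟘 else 𝟙

Ghostish : SB → Set
Ghostish x = (x ≡ 𝟘) ⊎ (x ≡ 𝟙ν)

DependentCols : ∀ {n} → Graph n → Sub n → Set
DependentCols {n} G S =
  Σ (Fin n → Bool) λ λ' →
    (∀ j → λ' j ≡ true → S j ≡ true) ×
    (∃ λ j → λ' j ≡ true) ×
    (∀ i → Ghostish (sumSB (λ j → fromBool (λ' j) *ˢ Ac G i j)))

IndependentCols : ∀ {n} → Graph n → Sub n → Set
IndependentCols G S = ¬ DependentCols G S

IsRankAc : ∀ {n} → Graph n → ℕ → Set
IsRankAc G r =
  (Σ (Sub _) λ S → IndependentCols G S × count S ≡ r) ×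
  (∀ S → IndependentCols G S → count S ≤ r)

module Submission where

-- Call a sequence of vertex pairs (r₁ , s₁) ∷ … ∷ (r_m , s_m) a staircase if
-- rᵢ is not adjacent to sᵢ but is adjacent to every later column vertex sⱼ
-- (j > i); in other words rows r and columns s of A^c span a unitriangular
-- m × m submatrix.  Staircases measure both sides of the theorem:
--   * the columns of a staircase are independent; conversely a nonempty
--     independent set of columns has a row meeting it in exactly one 1, so
--     removing that column and recursing turns k independent columns into a
--     staircase of length k;
--   * the stars St{sᵢ , … , s_m} of the column suffixes of a staircase form a
--     chain of length m in Fl G; conversely the elements witnessing the strict
--     inclusions of a chain of length m in Fl G give a staircase of length m.
-- Existence of a staircase of given length is decidable by exhaustive search
-- and its length is at most n, so there is a longest staircase; its length is
-- both the rank of A^c and the height of Fl G.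

open import Defs
open import Data.Nat using (ℕ; zero; suc; _+_; _≤_; z≤n; s≤s)
open import Data.Nat.Properties using (≤-trans; ≤-pred; n≤1+n; m≤n⇒m<n∨m≡n; +-suc; suc-injective)
open import Data.Fin using (Fin; zero; suc; inject₁)
open import Data.Fin.Properties using (_≟_; any?; ¬∀⟶∃¬) renaming (suc-injective to Fin-suc-injective)
open import Data.Bool using (Bool; true; false; if_then_else_; not; _∧_; _∨_)
open import Data.Bool.Properties using (∨-zeroʳ; ∧-zeroʳ; ∧-identityʳ; ¬-not) renaming (_≟_ to _≟ᵇ_)
open import Data.Product using (Σ; ∃; _×_; _,_; proj₁; proj₂)
open import Data.Sum using (_⊎_; inj₁; inj₂)
open import Data.Vec using (Vec; []; _∷_)
open import Data.Unit using (⊤; tt)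
open import Data.Empty using (⊥-elim)
open import Function using (_∘_; case_of_)
open import Relation.Binary.PropositionalEquality using (_≡_; _≢_; refl; trans; cong; subst) renaming (sym to ≡-sym)
open import Relation.Nullary using (¬_; Dec; yes; no; does)
open import Relation.Nullary.Decidable using (dec-true; dec-false; map′; _×-dec_)

allFin-true : ∀ {n} (f : Fin n → Bool) → allFin f ≡ true → ∀ i → f i ≡ true
allFin-true {suc n} f all-f i with f zero in f₀
allFin-true {suc n} f all-f zero    | true = f₀
allFin-true {suc n} f all-f (suc i) | true = allFin-true (f ∘ suc) all-f i

allFin-intro : ∀ {n} (f : Fin n → Bool) → (∀ i → f i ≡ true) → allFin f ≡ true
allFin-intro {zero}  f every = refl
allFin-intro {suc n} f every rewrite every zero = allFin-intro (f ∘ suc) (every ∘ suc)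

allFin-false : ∀ {n} (f : Fin n → Bool) → allFin f ≡ false → ∃ λ i → f i ≡ false
allFin-false {suc n} f not-all with f zero in f₀
... | false = zero , f₀
... | true  = let (i , fi) = allFin-false (f ∘ suc) not-all in suc i , fi

_∈ˢ_ : ∀ {n} → Fin n → Sub n → Set
j ∈ˢ X = X j ≡ true

_⊆ˢ_ : ∀ {n} → Sub n → Sub n → Set
X ⊆ˢ Y = ∀ j → j ∈ˢ X → j ∈ˢ Y

∅ : ∀ {n} → Sub n
∅ _ = false

insert : ∀ {n} → Fin n → Sub n → Sub n
insert s X j = does (s ≟ j) ∨ X j

remove : ∀ {n} → Fin n → Sub n → Sub n
remove s X j = X j ∧ not (does (s ≟ j))

module _ {n : ℕ} (s : Fin n) (X : Sub n) where

  insert-here : s ∈ˢ insert s X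
  insert-here rewrite dec-true (s ≟ s) refl = refl

  insert-there : X ⊆ˢ insert s X
  insert-there j j∈X rewrite j∈X = ∨-zeroʳ (does (s ≟ j))

  insert-away : ∀ j → s ≢ j → insert s X j ≡ X j
  insert-away j s≢j rewrite dec-false (s ≟ j) s≢j = refl

  insert-cases : ∀ j → j ∈ˢ insert s X → s ≡ j ⊎ j ∈ˢ X
  insert-cases j j∈ with s ≟ j
  ... | yes s≡j = inj₁ s≡j
  ... | no  _   = inj₂ j∈

  remove-⊆ : remove s X ⊆ˢ X
  remove-⊆ j j∈ with X j
  ... | true = refl

  remove-here : remove s X s ≡ false
  remove-here rewrite dec-true (s ≟ s) refl = ∧-zeroʳ (X s)

  remove-away : ∀ j → s ≢ j → remove s X j ≡ X j
  remove-away j s≢j rewrite dec-false (s ≟ j) s≢j = ∧-identityʳ (X j)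

  remove-≢ : ∀ j → j ∈ˢ remove s X → s ≢ j
  remove-≢ j j∈ refl with () ← trans (≡-sym j∈) remove-here

count-ext : ∀ {n} (X Y : Sub n) → (∀ j → X j ≡ Y j) → count X ≡ count Y
count-ext {zero}  X Y same = refl
count-ext {suc n} X Y same rewrite same zero =
  cong ((if Y zero then 1 else 0) +_) (count-ext (X ∘ suc) (Y ∘ suc) (same ∘ suc))

count-∅ : ∀ {n} → count (∅ {n}) ≡ 0
count-∅ {zero}  = refl
count-∅ {suc n} = count-∅ {n}

count-≤ : ∀ {n} (X : Sub n) → count X ≤ n
count-≤ {zero}  X = z≤n
count-≤ {suc n} X with X zero
... | true  = s≤s (count-≤ (X ∘ suc))
... | false = ≤-trans (count-≤ (X ∘ suc)) (n≤1+n n)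

count-nonempty : ∀ {n} (X : Sub n) {c} → count X ≡ suc c → ∃ λ j → j ∈ˢ X
count-nonempty {suc n} X size with X zero in X₀
... | true  = zero , X₀
... | false = let (j , j∈) = count-nonempty (X ∘ suc) size in suc j , j∈

count-differ : ∀ {n} (X Y : Sub n) s → s ∈ˢ X → Y s ≡ false → (∀ j → s ≢ j → X j ≡ Y j) →
               count X ≡ suc (count Y)
count-differ {suc n} X Y zero s∈X s∉Y same rewrite s∈X | s∉Y =
  cong suc (count-ext (X ∘ suc) (Y ∘ suc) (λ j → same (suc j) λ ()))
count-differ {suc n} X Y (suc s) s∈X s∉Y same rewrite same zero (λ ()) =
  trans (cong (bit₀ +_) tails) (+-suc bit₀ (count (Y ∘ suc)))
  where
  bit₀ : ℕ
  bit₀ = if Y zero then 1 else 0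
  tails : count (X ∘ suc) ≡ suc (count (Y ∘ suc))
  tails = count-differ (X ∘ suc) (Y ∘ suc) s s∈X s∉Y (λ j s≢j → same (suc j) (s≢j ∘ Fin-suc-injective))

count-insert : ∀ {n} s (X : Sub n) → X s ≡ false → count (insert s X) ≡ suc (count X)
count-insert s X s∉X = count-differ (insert s X) X s (insert-here s X) s∉X (insert-away s X)

count-remove : ∀ {n} s (X : Sub n) → s ∈ˢ X → count X ≡ suc (count (remove s X))
count-remove s X s∈X =
  count-differ X (remove s X) s s∈X (remove-here s X) (λ j s≢j → ≡-sym (remove-away s X j s≢j))

Bit : SB → Set
Bit x = (x ≡ 𝟘) ⊎ (x ≡ 𝟙)

ghostish? : ∀ x → Dec (Ghostish x)
ghostish? 𝟘  = yes (inj₁ refl)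
ghostish? 𝟙  = no λ { (inj₁ ()) ; (inj₂ ()) }
ghostish? 𝟙ν = yes (inj₂ refl)

non-ghostish-is-𝟙 : ∀ x → ¬ Ghostish x → x ≡ 𝟙
non-ghostish-is-𝟙 𝟘  not-ghost = ⊥-elim (not-ghost (inj₁ refl))
non-ghostish-is-𝟙 𝟙  not-ghost = refl
non-ghostish-is-𝟙 𝟙ν not-ghost = ⊥-elim (not-ghost (inj₂ refl))

𝟙-not-ghostish : ¬ Ghostish 𝟙
𝟙-not-ghostish (inj₁ ())
𝟙-not-ghostish (inj₂ ())

𝟙+ˢ-cancel : ∀ y → 𝟙 +ˢ y ≡ 𝟙 → y ≡ 𝟘
𝟙+ˢ-cancel 𝟘 _ = refl

+ˢ-zero : ∀ x y → x +ˢ y ≡ 𝟘 → (x ≡ 𝟘) × (y ≡ 𝟘)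
+ˢ-zero 𝟘 y sum≡𝟘 = refl , sum≡𝟘
+ˢ-zero 𝟙 𝟘 ()
+ˢ-zero 𝟙 𝟙 ()
+ˢ-zero 𝟙 𝟙ν ()

sum-zero : ∀ {k} (f : Fin k → SB) → sumSB f ≡ 𝟘 → ∀ j → f j ≡ 𝟘
sum-zero {suc k} f sum≡𝟘 zero    = proj₁ (+ˢ-zero _ _ sum≡𝟘)
sum-zero {suc k} f sum≡𝟘 (suc j) = sum-zero (f ∘ suc) (proj₂ (+ˢ-zero _ _ sum≡𝟘)) j

sum-of-zeros : ∀ {k} (f : Fin k → SB) → (∀ j → f j ≡ 𝟘) → sumSB f ≡ 𝟘
sum-of-zeros {zero}  f zeros = refl
sum-of-zeros {suc k} f zeros rewrite zeros zero = sum-of-zeros (f ∘ suc) (zeros ∘ suc)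

sum-bits-𝟙 : ∀ {k} (f : Fin k → SB) → (∀ j → Bit (f j)) → sumSB f ≡ 𝟙 →
             ∃ λ s → (f s ≡ 𝟙) × (∀ j → s ≢ j → f j ≡ 𝟘)
sum-bits-𝟙 {suc k} f bits sum≡𝟙 with bits zero
... | inj₁ f₀≡𝟘 =
  let (s , fs , rest) = sum-bits-𝟙 (f ∘ suc) (bits ∘ suc) (subst (λ x → x +ˢ sumSB (f ∘ suc) ≡ 𝟙) f₀≡𝟘 sum≡𝟙)
  in suc s , fs , λ { zero _ → f₀≡𝟘 ; (suc j) s≢j → rest j (s≢j ∘ cong suc) }
... | inj₂ f₀≡𝟙 =
  let tail≡𝟘 = 𝟙+ˢ-cancel _ (subst (λ x → x +ˢ sumSB (f ∘ suc) ≡ 𝟙) f₀≡𝟙 sum≡𝟙)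
  in zero , f₀≡𝟙 , λ { zero z≢z → ⊥-elim (z≢z refl) ; (suc j) _ → sum-zero (f ∘ suc) tail≡𝟘 j }

sum-single : ∀ {k} (f : Fin k → SB) s → f s ≡ 𝟙 → (∀ j → s ≢ j → f j ≡ 𝟘) → sumSB f ≡ 𝟙
sum-single {suc k} f zero fs rest
  rewrite fs | sum-of-zeros (f ∘ suc) (λ j → rest (suc j) λ ()) = refl
sum-single {suc k} f (suc s) fs rest rewrite rest zero (λ ()) =
  sum-single (f ∘ suc) s fs (λ j s≢j → rest (suc j) (s≢j ∘ Fin-suc-injective))

Searchable : Set → Set₁
Searchable A = (Q : A → Set) → (∀ a → Dec (Q a)) → Dec (Σ A Q)

search-Fin : ∀ n → Searchable (Fin n)
search-Fin n Q Q? = any? Q?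

search-× : ∀ {A B} → Searchable A → Searchable B → Searchable (A × B)
search-× search-A search-B Q Q? =
  map′ (λ (a , b , q) → (a , b) , q) (λ ((a , b) , q) → a , b , q)
       (search-A _ λ a → search-B _ λ b → Q? (a , b))

search-Vec : ∀ {A} → Searchable A → ∀ m → Searchable (Vec A m)
search-Vec search-A zero Q Q? = map′ ([] ,_) (λ { ([] , q) → q }) (Q? [])
search-Vec search-A (suc m) Q Q? =
  map′ (λ (x , xs , q) → x ∷ xs , q) (λ { (x ∷ xs , q) → x , xs , q })
       (search-A _ λ x → search-Vec search-A m _ λ xs → Q? (x ∷ xs))

largest : (P : ℕ → Set) → (∀ m → Dec (P m)) → P 0 → ∀ b → (∀ m → P m → m ≤ b) →
          Σ ℕ λ k → P k × (∀ m → P m → m ≤ k)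
largest P P? P0 b bounded =
  let (k , Pk , below) = largest-upto b in k , Pk , λ m Pm → below m Pm (bounded m Pm)
  where
  largest-upto : ∀ b → Σ ℕ λ k → P k × (∀ m → P m → m ≤ b → m ≤ k)
  largest-upto zero = 0 , P0 , λ _ _ m≤0 → m≤0
  largest-upto (suc b) with P? (suc b) | largest-upto b
  ... | yes Pb | _ = suc b , Pb , λ _ _ m≤b → m≤b
  ... | no ¬Pb | k , Pk , below = k , Pk , λ m Pm m≤1+b → case m≤n⇒m<n∨m≡n m≤1+b of λ where
    (inj₁ m<1+b) → below m Pm (≤-pred m<1+b)
    (inj₂ refl)  → ⊥-elim (¬Pb Pm)

module Staircases {n : ℕ} (G : Graph n) where

  St-adjacent : ∀ W r w → r ∈ˢ St G W → w ∈ˢ W → adj G r w ≡ true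
  St-adjacent W r w r∈St w∈W =
    trans (Graph.sym G r w) (subst (λ b → not b ∨ adj G w r ≡ true) w∈W (allFin-true _ r∈St w))

  St-intro : ∀ W r → (∀ w → w ∈ˢ W → adj G r w ≡ true) → r ∈ˢ St G W
  St-intro W r adjacent = allFin-intro _ condition
    where
    condition : ∀ w → not (W w) ∨ adj G w r ≡ true
    condition w with W w in w∈W
    ... | false = refl
    ... | true  = trans (Graph.sym G w r) (adjacent w w∈W)

  St-missing : ∀ W r → St G W r ≡ false → ∃ λ w → w ∈ˢ W × (adj G r w ≡ false)
  St-missing W r r∉St with allFin-false _ r∉St
  ... | w , condition with W w in w∈W
  ... | true = w , w∈W , trans (Graph.sym G r w) condition

  St-antitone : ∀ W W' → W' ⊆ˢ W → St G W ⊆ˢ St G W'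
  St-antitone W W' W'⊆W r r∈St = St-intro W' r λ w w∈W' → St-adjacent W r w r∈St (W'⊆W w w∈W')

  St-insert : ∀ W r s → r ∈ˢ St G W → adj G r s ≡ true → r ∈ˢ St G (insert s W)
  St-insert W r s r∈St r~s = St-intro (insert s W) r λ w w∈ → case insert-cases s W w w∈ of λ where
    (inj₁ refl) → r~s
    (inj₂ w∈W)  → St-adjacent W r w r∈St w∈W

  Pair : Set
  Pair = Fin n × Fin n

  cols : ∀ {m} → Vec Pair m → Sub n
  cols []            = ∅
  cols ((_ , s) ∷ v) = insert s (cols v)

  Staircase : ∀ {m} → Vec Pair m → Set
  Staircase []            = ⊤
  Staircase ((r , s) ∷ v) = (adj G r s ≡ false) × (r ∈ˢ St G (cols v)) × Staircase v

  staircase? : ∀ {m} (v : Vec Pair m) → Dec (Staircase v)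
  staircase? []            = yes tt
  staircase? ((r , s) ∷ v) = (adj G r s ≟ᵇ false) ×-dec (St G (cols v) r ≟ᵇ true) ×-dec staircase? v

  HasStaircase : ℕ → Set
  HasStaircase m = Σ (Vec Pair m) Staircase

  hasStaircase? : ∀ m → Dec (HasStaircase m)
  hasStaircase? m = search-Vec (search-× (search-Fin n) (search-Fin n)) m Staircase staircase?

  -- The diagonal row r sees every later column but not s, so s is new.
  staircase-fresh : ∀ {m} r s (v : Vec Pair m) → Staircase ((r , s) ∷ v) → cols v s ≡ false
  staircase-fresh r s v (r≁s , r∈St , _) = ¬-not λ s∈ → case trans (≡-sym (St-adjacent _ r s r∈St s∈)) r≁s of λ ()

  staircase-count : ∀ {m} (v : Vec Pair m) → Staircase v → count (cols v) ≡ m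
  staircase-count []            _ = count-∅ {n}
  staircase-count ((r , s) ∷ v) stairs@(_ , _ , rest) =
    trans (count-insert s (cols v) (staircase-fresh r s v stairs)) (cong suc (staircase-count v rest))

  staircase-length : ∀ m → HasStaircase m → m ≤ n
  staircase-length m (v , stairs) = subst (_≤ n) (staircase-count v stairs) (count-≤ (cols v))

  summand : Sub n → Fin n → Fin n → SB
  summand L i j = fromBool (L j) *ˢ Ac G i j

  summand-bit : ∀ L i j → Bit (summand L i j)
  summand-bit L i j with L j | adj G i j
  ... | true  | true  = inj₁ refl
  ... | true  | false = inj₂ refl
  ... | false | _     = inj₁ refl

  summand-𝟙 : ∀ L i j → summand L i j ≡ 𝟙 → j ∈ˢ L × (adj G i j ≡ false)
  summand-𝟙 L i j is-𝟙 with L j | adj G i j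
  ... | true | false = refl , refl

  summand-diagonal : ∀ L i j → j ∈ˢ L → adj G i j ≡ false → summand L i j ≡ 𝟙
  summand-diagonal L i j j∈L i≁j rewrite j∈L | i≁j = refl

  summand-𝟘 : ∀ L i j → summand L i j ≡ 𝟘 → j ∈ˢ L → adj G i j ≡ true
  summand-𝟘 L i j is-𝟘 j∈L rewrite j∈L with adj G i j
  ... | true = refl

  summand-off : ∀ L i j → (j ∈ˢ L → adj G i j ≡ true) → summand L i j ≡ 𝟘
  summand-off L i j adjacent with L j
  ... | false = refl
  ... | true rewrite adjacent refl = refl

  -- Staircase columns are independent: in a dependence its first column s
  -- would make row r sum to exactly 𝟙.

  staircase-independent : ∀ {m} (v : Vec Pair m) → Staircase v → IndependentCols G (cols v)
  staircase-independent [] _ (L , L⊆∅ , (j , j∈L) , _) with () ← L⊆∅ j j∈L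
  staircase-independent ((r , s) ∷ v) (r≁s , r∈St , rest) (L , L⊆cols , nonzero , ghostish)
    with L s in s∈L
  ... | true  = 𝟙-not-ghostish (subst Ghostish row-r (ghostish r))
    where
    row-r : sumSB (summand L r) ≡ 𝟙
    row-r = sum-single (summand L r) s (summand-diagonal L r s s∈L r≁s) λ j s≢j →
      summand-off L r j λ j∈L → case insert-cases s (cols v) j (L⊆cols j j∈L) of λ where
        (inj₁ s≡j)    → ⊥-elim (s≢j s≡j)
        (inj₂ j∈cols) → St-adjacent _ r j r∈St j∈cols
  ... | false = staircase-independent v rest (L , L⊆tail , nonzero , ghostish)
    where
    L⊆tail : L ⊆ˢ cols v
    L⊆tail j j∈L = case insert-cases s (cols v) j (L⊆cols j j∈L) of λ where
      (inj₁ refl)   → case trans (≡-sym j∈L) s∈L of λ ()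
      (inj₂ j∈cols) → j∈cols

  independent-subset : ∀ S T → S ⊆ˢ T → IndependentCols G T → IndependentCols G S
  independent-subset S T S⊆T independent (L , L⊆S , dependence) =
    independent (L , (λ j j∈L → S⊆T j (L⊆S j j∈L)) , dependence)

  -- Summing all columns of a nonempty independent set S is no dependence, so
  -- some row sum is not ghostish.
  non-ghostish-row : ∀ S → IndependentCols G S → ∃ (_∈ˢ S) →
                     ∃ λ i → ¬ Ghostish (sumSB (summand S i))
  non-ghostish-row S independent nonempty =
    ¬∀⟶∃¬ n _ (λ i → ghostish? _) λ all-ghostish →
      independent (S , (λ _ j∈S → j∈S) , nonempty , all-ghostish)

  isolating-row : ∀ S → IndependentCols G S → ∃ (_∈ˢ S) →
                  Σ Pair λ (i , s) → s ∈ˢ S × (adj G i s ≡ false) ×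
                                     (∀ j → j ∈ˢ S → s ≢ j → adj G i j ≡ true)
  isolating-row S independent nonempty
    with non-ghostish-row S independent nonempty
  ... | i , row-not-ghostish
    with sum-bits-𝟙 (summand S i) (summand-bit S i) (non-ghostish-is-𝟙 _ row-not-ghostish)
  ... | s , single , others =
    (i , s) , proj₁ (summand-𝟙 S i s single) , proj₂ (summand-𝟙 S i s single) ,
    λ j j∈S s≢j → summand-𝟘 S i j (others j s≢j) j∈S

  independent-staircase : ∀ c S → count S ≡ c → IndependentCols G S →
                          Σ (Vec Pair c) λ v → Staircase v × cols v ⊆ˢ S
  independent-staircase zero S _ _ = [] , tt , λ _ ()
  independent-staircase (suc c) S size independent
    with isolating-row S independent (count-nonempty S size)
  ... | (i , s) , s∈S , i≁s , i~others
    with independent-staircase c (remove s S) (suc-injective (trans (≡-sym (count-remove s S s∈S)) size))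
                               (independent-subset (remove s S) S (remove-⊆ s S) independent)
  ... | v , stairs , v⊆S' = (i , s) ∷ v , (i≁s , i∈St , stairs) , cols⊆S
    where
    i∈St : i ∈ˢ St G (cols v)
    i∈St = St-intro (cols v) i λ w w∈ →
      i~others w (remove-⊆ s S w (v⊆S' w w∈)) (remove-≢ s S w (v⊆S' w w∈))
    cols⊆S : cols ((i , s) ∷ v) ⊆ˢ S
    cols⊆S j j∈ = case insert-cases s (cols v) j j∈ of λ where
      (inj₁ refl) → s∈S
      (inj₂ j∈v)  → remove-⊆ s S j (v⊆S' j j∈v)

  star-step : ∀ {m} r s (v : Vec Pair m) → Staircase ((r , s) ∷ v) →
              St G (cols ((r , s) ∷ v)) ⊂ St G (cols v)
  star-step r s v (r≁s , r∈St , _) =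
    St-antitone _ _ (insert-there s (cols v)) ,
    r , r∈St , ¬-not λ r∈ → case trans (≡-sym (St-adjacent _ r s r∈ (insert-here s (cols v)))) r≁s of λ ()

  suffix-stars : ∀ {m} → Vec Pair m → Fin (suc m) → Sub n
  suffix-stars v       zero    = St G (cols v)
  suffix-stars (_ ∷ v) (suc i) = suffix-stars v i

  suffix-stars-inFl : ∀ {m} (v : Vec Pair m) i → InFl G (suffix-stars v i)
  suffix-stars-inFl v       zero    = cols v , λ _ → refl
  suffix-stars-inFl (_ ∷ v) (suc i) = suffix-stars-inFl v i

  suffix-stars-incr : ∀ {m} (v : Vec Pair m) → Staircase v →
                      ∀ i → suffix-stars v (inject₁ i) ⊂ suffix-stars v (suc i)
  suffix-stars-incr ((r , s) ∷ v) stairs           zero    = star-step r s v stairs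
  suffix-stars-incr (_ ∷ v)       (_ , _ , stairs) (suc i) = suffix-stars-incr v stairs i

  staircase-chain : ∀ {m} → HasStaircase m → Chain G m
  staircase-chain (v , stairs) = record
    { p = suffix-stars v ; inFl = suffix-stars-inFl v ; incr = suffix-stars-incr v stairs }

  chain-tail : ∀ {m} → Chain G (suc m) → Chain G m
  chain-tail c = record { p = Chain.p c ∘ suc ; inFl = Chain.inFl c ∘ suc ; incr = Chain.incr c ∘ suc }

  -- Conversely, a chain p₀ ⊂ … ⊂ p_m in Fl G gives a staircase whose
  -- smallest star contains p₀: an element x ∈ p₁ ∖ p₀ = p₁ ∖ St W₀ is
  -- non-adjacent to some w ∈ W₀, and (x , w) is the new first stair.
  chain-staircase : ∀ {m} (c : Chain G m) →
                    Σ (Vec Pair m) λ v → Staircase v × Chain.p c zero ⊆ˢ St G (cols v)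
  chain-staircase {zero} c = [] , tt , λ y _ → St-intro ∅ y λ _ ()
  chain-staircase {suc m} c
    with Chain.inFl c zero | Chain.incr c zero | chain-staircase (chain-tail c)
  ... | W₀ , p₀≡St | p₀⊆p₁ , x , x∈p₁ , x∉p₀ | v , stairs , p₁⊆
    with St-missing W₀ x (trans (≡-sym (p₀≡St x)) x∉p₀)
  ... | w , w∈W₀ , x≁w = (x , w) ∷ v , (x≁w , p₁⊆ x x∈p₁ , stairs) , p₀⊆
    where
    p₀⊆ : Chain.p c zero ⊆ˢ St G (insert w (cols v))
    p₀⊆ y y∈p₀ = St-insert (cols v) y w (p₁⊆ y (p₀⊆p₁ y y∈p₀))
                   (St-adjacent W₀ y w (trans (≡-sym (p₀≡St y)) y∈p₀) w∈W₀)

theorem3p3 : ∀ (n : ℕ) (G : Graph n) → Σ ℕ λ k → IsRankAc G k × IsHeight G k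
theorem3p3 n G = from-longest (largest HasStaircase hasStaircase? ([] , tt) n staircase-length)
  where
  open Staircases G

  from-longest : Σ ℕ (λ k → HasStaircase k × (∀ m → HasStaircase m → m ≤ k)) →
                 Σ ℕ λ k → IsRankAc G k × IsHeight G k
  from-longest (k , (v , stairs) , maximal) =
    k , ((cols v , staircase-independent v stairs , staircase-count v stairs) , rank-bound) ,
        (staircase-chain (v , stairs) , height-bound)
    where
    rank-bound : ∀ S → IndependentCols G S → count S ≤ k
    rank-bound S independent =
      let (w , w-stairs , _) = independent-staircase (count S) S refl independent
      in maximal (count S) (w , w-stairs)

    height-bound : ∀ m → Chain G m → m ≤ k
    height-bound m c = let (w , w-stairs , _) = chain-staircase c in maximal m (w , w-stairs)
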